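{- For every Lengyel transfer game $L(b;x_1,y_1;x_2,y_2)$ and every $(x,y)\in\mathbb{N}^2$, $\mathcal{SG}(x,y+b)=\mathcal{SG}(x,y)\oplus 1$, where $\oplus$ denotes nim-addition (bitwise XOR).
   Context: For positive integers $b,x_1,x_2$ and nonnegative integers $y_1,y_2$, the Lengyel transfer game $L(b;x_1,y_1;x_2,y_2)$ is the impartial normal-play game on positions $(x,y)\in\mathbb{N}^2$ in which a move consists of adding one of $(0,-b)$, $(-x_1,y_1)$, $(-x_2,y_2)$ to the current position, provided the result lies in $\mathbb{N}^2$. $\mathcal{SG}(x,y)$ is the Sprague–Grundy value of $(x,y)$. -}

module Defs where

open import Data.Nat using (ℕ; zero; suc; _+_; _*_; _∸_; _≤_; _<_; _≤?_; _≟_; _≡ᵇ_; NonZero; s≤s; z≤n)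
open import Data.Nat.Properties using (m∸n≤m; ≤-<-trans; n<1+n)
open import Data.Nat.DivMod using (_/_; _%_; m/n<m)
open import Data.Nat.Induction using (<-wellFounded)
open import Data.Bool using (Bool; true; false; _xor_)
open import Data.List using (List; []; _∷_; length)
open import Data.List.Membership.DecPropositional _≟_ using (_∈?_)
open import Induction.WellFounded using (Acc; acc)
open import Relation.Nullary using (Dec; yes; no)

lowBit : ℕ → Bool
lowBit n = (n % 2) ≡ᵇ 1

bitVal : Bool → ℕ
bitVal true  = 1
bitVal false = 0

nimAcc : (n m : ℕ) → Acc _<_ n → ℕ
nimAcc zero    m _       = m
nimAcc (suc n) m (acc r) =
  bitVal (lowBit (suc n) xor lowBit m)
    + 2 * nimAcc (suc n / 2) (m / 2) (r (m/n<m (suc n) 2 (s≤s (s≤s z≤n))))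

infixl 6 _⊕_
_⊕_ : ℕ → ℕ → ℕ
n ⊕ m = nimAcc n m (<-wellFounded n)

-- search k, k+1, ... ; the answer is at most length l, so length l
-- steps of fuel always suffice.
mexGo : List ℕ → ℕ → ℕ → ℕ
mexGo l k zero    = k
mexGo l k (suc f) with k ∈? l
... | yes _ = mexGo l (suc k) f
... | no  _ = k

mex : List ℕ → ℕ
mex l = mexGo l 0 (length l)

record LengyelGame : Set where
  field
    b  : ℕ
    x₁ : ℕ
    y₁ : ℕ
    x₂ : ℕ
    y₂ : ℕ
    b-pos  : 1 ≤ b
    x₁-pos : 1 ≤ x₁
    x₂-pos : 1 ≤ x₂

private
  ∸-< : ∀ {k n} → 1 ≤ k → k ≤ n → n ∸ k < n
  ∸-< {suc k} {suc n} _ _ = ≤-<-trans (m∸n≤m n k) (n<1+n n)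

-- Moves from (x , y):
--   (x , y ∸ b)         if b ≤ y
--   (x ∸ x₁ , y + y₁)   if x₁ ≤ x
--   (x ∸ x₂ , y + y₂)   if x₂ ≤ x
-- SG (x , y) = mex of the SG values of the options.
addIf : {P : Set} {A : Set} → Dec P → (P → A) → List A → List A
addIf (yes p) f l = f p ∷ l
addIf (no  _) f l = l

module _ (G : LengyelGame) where
  open LengyelGame G

  sgRow : (x : ℕ) → ((x' : ℕ) → x' < x → ℕ → ℕ) → (y : ℕ) → Acc _<_ y → ℕ
  sgRow x below y (acc ry) =
    mex ( addIf (b ≤? y)  (λ p → sgRow x below (y ∸ b) (ry (∸-< b-pos p)))
        ( addIf (x₁ ≤? x) (λ p → below (x ∸ x₁) (∸-< x₁-pos p) (y + y₁))
        ( addIf (x₂ ≤? x) (λ p → below (x ∸ x₂) (∸-< x₂-pos p) (y + y₂))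
          [] )))

  sgAcc : (x : ℕ) → Acc _<_ x → ℕ → ℕ
  sgAcc x (acc rx) y = sgRow x (λ x' lt → sgAcc x' (rx lt)) y (<-wellFounded y)

  SG : ℕ → ℕ → ℕ
  SG x y = sgAcc x (<-wellFounded x) y

{-# OPTIONS --safe #-}
-- Write v′ for v ⊕ 1, the involution swapping 2k and 2k + 1,
-- and g = SG(x, y).  The options of (x, y + b) are (x, y), of value g, and the transfers
-- (x ∸ xᵢ, y + b + yᵢ), whose values are v′ for the transfer values v of (x, y) by
-- induction on x; the remaining option (x, y ∸ b) of (x, y) has value g′ by induction
-- on y.  So the option values of (x, y + b) are g and the images under ′ of those of
-- (x, y), and since every j < g′ other than g has j′ < g, the mex moves from g to g′.
module Submission where

open import Defs
open import Data.Bool using (true; false; not; _xor_)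
open import Data.Bool.Properties using (xor-comm; true-xor; xor-identityʳ)
open import Data.Empty using (⊥-elim)
open import Data.Fin using (Fin; toℕ)
open import Data.Fin.Properties using (injective⇒≤; toℕ-injective; toℕ<n)
open import Data.List using (List; []; _∷_; length)
open import Data.List.Membership.Propositional using (_∈_)
open import Data.List.Membership.Setoid.Properties using (index-injective)
open import Data.List.Relation.Unary.Any using (here; there; index)
open import Data.Nat using (ℕ; zero; suc; _+_; _*_; _∸_; _≤_; _<_; _≤?_; _≟_; s≤s; z≤n)
open import Data.Nat.DivMod using (_/_; _%_; m≡m%n+[m/n]*n; m%n<n; m/n≡1+[m∸n]/n)
open import Data.Nat.Induction using (<-wellFounded; <-rec)
open import Data.Nat.Properties
open import Algebra.Properties.CommutativeSemigroup +-commutativeSemigroup using (xy∙z≈xz∙y)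
open import Data.List.Membership.DecPropositional _≟_ using (_∈?_)
open import Data.Product using (_×_; _,_)
open import Data.Sum using (_⊎_; inj₁; inj₂)
open import Function using (_∘_)
open import Induction.WellFounded using (Acc; acc)
open import Relation.Binary.Definitions using (tri<; tri≈; tri>)
open import Relation.Binary.PropositionalEquality
open import Relation.Nullary using (Dec; yes; no; ¬_)

flipLowBit : ℕ → ℕ
flipLowBit 0             = 1
flipLowBit 1             = 0
flipLowBit (suc (suc n)) = suc (suc (flipLowBit n))

flipLowBit-involutive : ∀ n → flipLowBit (flipLowBit n) ≡ n
flipLowBit-involutive 0             = refl
flipLowBit-involutive 1             = refl
flipLowBit-involutive (suc (suc n)) = cong (2 +_) (flipLowBit-involutive n)

flipLowBit-≢ : ∀ n → flipLowBit n ≢ n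
flipLowBit-≢ 0             ()
flipLowBit-≢ 1             ()
flipLowBit-≢ (suc (suc n)) eq = flipLowBit-≢ n (suc-injective (suc-injective eq))

flipLowBit-< : ∀ m k → k < flipLowBit m → k ≢ m → flipLowBit k < m
flipLowBit-< 0             0             _               k≢m = ⊥-elim (k≢m refl)
flipLowBit-< 0             (suc k)       (s≤s ())        _
flipLowBit-< (suc (suc m)) 0             _               _   = s≤s (s≤s z≤n)
flipLowBit-< (suc (suc m)) 1             _               _   = s≤s z≤n
flipLowBit-< (suc (suc m)) (suc (suc k)) (s≤s (s≤s k<)) k≢m =
  s≤s (s≤s (flipLowBit-< m k k< (k≢m ∘ cong (2 +_))))

bitVal-lowBit : ∀ m → bitVal (lowBit m) ≡ m % 2
bitVal-lowBit m with m % 2 | m%n<n m 2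
... | 0 | _ = refl
... | 1 | _ = refl
... | suc (suc _) | s≤s (s≤s ())

flipLowBit-digits : ∀ m → flipLowBit m ≡ bitVal (not (lowBit m)) + 2 * (m / 2)
flipLowBit-digits 0             = refl
flipLowBit-digits 1             = refl
flipLowBit-digits (suc (suc m)) = begin
  2 + flipLowBit m                            ≡⟨ cong (2 +_) (flipLowBit-digits m) ⟩
  2 + (c + 2 * (m / 2))                       ≡⟨ trans (+-suc c _) (cong suc (+-suc c _)) ⟨
  c + (2 + 2 * (m / 2))                       ≡⟨ cong (c +_) (*-suc 2 (m / 2)) ⟨
  c + 2 * suc (m / 2)                         ≡⟨ cong (λ q → c + 2 * q) (m/n≡1+[m∸n]/n {suc (suc m)} {2} (s≤s (s≤s z≤n))) ⟨
  c + 2 * (suc (suc m) / 2)                   ∎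
  where
  open ≡-Reasoning
  c = bitVal (not (lowBit m))

nimAcc-identityʳ : ∀ n (a : Acc _<_ n) → nimAcc n 0 a ≡ n
nimAcc-identityʳ zero    _       = refl
nimAcc-identityʳ (suc n) (acc r) = begin
  bitVal (lowBit (suc n) xor false) + 2 * nimAcc (suc n / 2) 0 _
    ≡⟨ cong₂ (λ c q → bitVal c + 2 * q) (xor-identityʳ (lowBit (suc n))) (nimAcc-identityʳ (suc n / 2) _) ⟩
  bitVal (lowBit (suc n)) + 2 * (suc n / 2)                       ≡⟨ cong₂ _+_ (bitVal-lowBit (suc n)) (*-comm 2 (suc n / 2)) ⟩
  suc n % 2 + suc n / 2 * 2                                       ≡⟨ m≡m%n+[m/n]*n (suc n) 2 ⟨
  suc n                                                           ∎
  where open ≡-Reasoning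

⊕1≡flipLowBit : ∀ n → n ⊕ 1 ≡ flipLowBit n
⊕1≡flipLowBit zero    = refl
⊕1≡flipLowBit (suc n) with <-wellFounded (suc n)
... | acc r = begin
  bitVal (lowBit (suc n) xor true) + 2 * nimAcc (suc n / 2) 0 _ ≡⟨ cong₂ (λ c q → bitVal c + 2 * q) xor-true (nimAcc-identityʳ (suc n / 2) _) ⟩
  bitVal (not (lowBit (suc n))) + 2 * (suc n / 2)                 ≡⟨ flipLowBit-digits (suc n) ⟨
  flipLowBit (suc n)                                              ∎
  where
  open ≡-Reasoning
  xor-true : lowBit (suc n) xor true ≡ not (lowBit (suc n))
  xor-true = trans (xor-comm _ true) (true-xor _)

record IsMex (P : ℕ → Set) (r : ℕ) : Set where
  constructor isMex
  field
    below    : ∀ {j} → j < r → P j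
    excluded : ¬ P r

IsMex-unique : ∀ {P r s} → IsMex P r → IsMex P s → r ≡ s
IsMex-unique {r = r} {s} mr ms with <-cmp r s
... | tri< r<s _ _ = ⊥-elim (IsMex.excluded mr (IsMex.below ms r<s))
... | tri≈ _ r≡s _ = r≡s
... | tri> _ _ s<r = ⊥-elim (IsMex.excluded ms (IsMex.below mr s<r))

extendBelow : ∀ {P : ℕ → Set} {k} → (∀ {j} → j < k → P j) → P k → ∀ {j} → j < suc k → P j
extendBelow below Pk j<1+k with m<1+n⇒m<n∨m≡n j<1+k
... | inj₁ j<k  = below j<k
... | inj₂ refl = Pk

below⊆⇒≤length : ∀ n (l : List ℕ) → (∀ {j} → j < n → j ∈ l) → n ≤ length l
below⊆⇒≤length n l below = injective⇒≤ position-injective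
  where
  position : Fin n → Fin (length l)
  position i = index (below (toℕ<n i))
  position-injective : ∀ {i i′} → position i ≡ position i′ → i ≡ i′
  position-injective eq = toℕ-injective (index-injective (setoid ℕ) _ _ eq)

mexGo-isMex : ∀ l k fuel → (∀ {j} → j < k → j ∈ l) → length l ≤ k + fuel →
              IsMex (_∈ l) (mexGo l k fuel)
mexGo-isMex l k zero below len = isMex below λ k∈l →
  -- k ∈ l would put the k + 1 distinct values 0, …, k into l, but length l ≤ k
  n≮n k (≤-trans (below⊆⇒≤length (suc k) l (extendBelow below k∈l)) (subst (length l ≤_) (+-identityʳ k) len))
mexGo-isMex l k (suc fuel) below len with k ∈? l
... | yes k∈l = mexGo-isMex l (suc k) fuel (extendBelow below k∈l) (subst (length l ≤_) (+-suc k fuel) len)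
... | no  k∉l = isMex below k∉l

mex-isMex : ∀ l → IsMex (_∈ l) (mex l)
mex-isMex l = mexGo-isMex l 0 (length l) (λ ()) ≤-refl

IsMex-flipLowBit : ∀ {S L : ℕ → Set} {g} → IsMex S g → L g →
                   (∀ {v} → S v → L (flipLowBit v)) →
                   (∀ {v} → L v → v ≡ g ⊎ S (flipLowBit v)) →
                   IsMex L (flipLowBit g)
IsMex-flipLowBit {S} {L} {g} (isMex belowS g∉S) Lg S⇒L L⇒S = isMex belowL flipLowBit-g∉L
  where
  belowL : ∀ {j} → j < flipLowBit g → L j
  belowL {j} j< with j ≟ g
  ... | yes refl = Lg
  ... | no  j≢g  = subst L (flipLowBit-involutive j) (S⇒L (belowS (flipLowBit-< g j j< j≢g)))
  flipLowBit-g∉L : ¬ L (flipLowBit g)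
  flipLowBit-g∉L L[flipLowBit-g] with L⇒S L[flipLowBit-g]
  ... | inj₁ eq = flipLowBit-≢ g eq
  ... | inj₂ S[g] = g∉S (subst S (flipLowBit-involutive g) S[g])

module _ {A : Set} {P : Set} where

  addIf-cong : ∀ (d : Dec P) {f g : P → A} {l l′ : List A} →
               (∀ p → f p ≡ g p) → l ≡ l′ → addIf d f l ≡ addIf d g l′
  addIf-cong (yes p) f≗g refl = cong (_∷ _) (f≗g p)
  addIf-cong (no  _) f≗g refl = refl

  ∈-addIf⁺ʰ : ∀ (d : Dec P) {v : A} {l} → P → v ∈ addIf d (λ _ → v) l
  ∈-addIf⁺ʰ (yes _) _ = here refl
  ∈-addIf⁺ʰ (no ¬p) p = ⊥-elim (¬p p)

  ∈-addIf⁺ᵗ : ∀ (d : Dec P) {f : P → A} {v l} → v ∈ l → v ∈ addIf d f l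
  ∈-addIf⁺ᵗ (yes _) v∈l = there v∈l
  ∈-addIf⁺ᵗ (no  _) v∈l = v∈l

  ∈-addIf⁻ : ∀ (d : Dec P) {u v : A} {l} → v ∈ addIf d (λ _ → u) l → (P × v ≡ u) ⊎ v ∈ l
  ∈-addIf⁻ (yes p) (here v≡u) = inj₁ (p , v≡u)
  ∈-addIf⁻ (yes _) (there v∈l) = inj₂ v∈l
  ∈-addIf⁻ (no  _) v∈l         = inj₂ v∈l

module _ (G : LengyelGame) where
  open LengyelGame G

  sgRow-cong : ∀ x (B B′ : (x′ : ℕ) → x′ < x → ℕ → ℕ) →
               (∀ {x′} (p q : x′ < x) y → B x′ p y ≡ B′ x′ q y) →
               ∀ y (a a′ : Acc _<_ y) → sgRow G x B y a ≡ sgRow G x B′ y a′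
  sgRow-cong x B B′ B≗B′ y (acc r) (acc r′) =
    cong mex (addIf-cong (b ≤? y) (λ _ → sgRow-cong x B B′ B≗B′ (y ∸ b) (r _) (r′ _))
               (addIf-cong (x₁ ≤? x) (λ _ → B≗B′ _ _ _)
                 (addIf-cong (x₂ ≤? x) (λ _ → B≗B′ _ _ _) refl)))

  sgAcc-irrelevant : ∀ x (a a′ : Acc _<_ x) y → sgAcc G x a y ≡ sgAcc G x a′ y
  sgAcc-irrelevant x (acc r) (acc r′) y =
    sgRow-cong x _ _ (λ p q → sgAcc-irrelevant _ (r p) (r′ q)) y (<-wellFounded y) (<-wellFounded y)

  sgAcc≡sgRow : ∀ x (ax : Acc _<_ x) y (ay : Acc _<_ y) →
                sgAcc G x ax y ≡ sgRow G x (λ x′ _ → SG G x′) y ay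
  sgAcc≡sgRow x (acc r) y ay =
    sgRow-cong x _ _ (λ p _ → sgAcc-irrelevant _ (r p) (<-wellFounded _)) y (<-wellFounded y) ay

  options : ℕ → ℕ → List ℕ
  options x y = addIf (b ≤? y)  (λ _ → SG G x (y ∸ b))
               (addIf (x₁ ≤? x) (λ _ → SG G (x ∸ x₁) (y + y₁))
               (addIf (x₂ ≤? x) (λ _ → SG G (x ∸ x₂) (y + y₂)) []))

  SG-unfold : ∀ x y → SG G x y ≡ mex (options x y)
  SG-unfold x y with <-wellFounded y
  ... | acc r =
    trans (sgAcc≡sgRow x (<-wellFounded x) y (acc r))
          (cong mex (addIf-cong (b ≤? y) (λ _ → sym (sgAcc≡sgRow x (<-wellFounded x) (y ∸ b) (r _))) refl))

  data OptionValue (x y : ℕ) : ℕ → Set where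
    take      : b ≤ y  → OptionValue x y (SG G x (y ∸ b))
    transfer₁ : x₁ ≤ x → OptionValue x y (SG G (x ∸ x₁) (y + y₁))
    transfer₂ : x₂ ≤ x → OptionValue x y (SG G (x ∸ x₂) (y + y₂))

  ∈-options⁺ : ∀ {x y v} → OptionValue x y v → v ∈ options x y
  ∈-options⁺ {x} {y} (take p)      = ∈-addIf⁺ʰ (b ≤? y) p
  ∈-options⁺ {x} {y} (transfer₁ p) = ∈-addIf⁺ᵗ (b ≤? y) (∈-addIf⁺ʰ (x₁ ≤? x) p)
  ∈-options⁺ {x} {y} (transfer₂ p) = ∈-addIf⁺ᵗ (b ≤? y) (∈-addIf⁺ᵗ (x₁ ≤? x) (∈-addIf⁺ʰ (x₂ ≤? x) p))

  ∈-options⁻ : ∀ {x y v} → v ∈ options x y → OptionValue x y v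
  ∈-options⁻ {x} {y} v∈ with ∈-addIf⁻ (b ≤? y) v∈
  ... | inj₁ (p , refl) = take p
  ... | inj₂ v∈′ with ∈-addIf⁻ (x₁ ≤? x) v∈′
  ... | inj₁ (p , refl) = transfer₁ p
  ... | inj₂ v∈″ with ∈-addIf⁻ (x₂ ≤? x) v∈″
  ... | inj₁ (p , refl) = transfer₂ p
  ... | inj₂ ()

  SG-isMex : ∀ x y → IsMex (OptionValue x y) (SG G x y)
  SG-isMex x y rewrite SG-unfold x y =
    isMex (∈-options⁻ ∘ IsMex.below mexSpec) (IsMex.excluded mexSpec ∘ ∈-options⁺)
    where mexSpec = mex-isMex (options x y)

  Shifts : ℕ → ℕ → Set
  Shifts x y = SG G x (y + b) ≡ flipLowBit (SG G x y)

  SG-shift-step : ∀ x y → (∀ {x′} → x′ < x → ∀ y′ → Shifts x′ y′) → (∀ {y′} → y′ < y → Shifts x y′) →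
                  Shifts x y
  SG-shift-step x y shiftsBelow shiftsLeft =
    IsMex-unique (SG-isMex x (y + b)) (IsMex-flipLowBit (SG-isMex x y) take-back shift⁺ shift⁻)
    where
    y+b∸b≡y : y + b ∸ b ≡ y
    y+b∸b≡y = m+n∸n≡m y b

    take-back : OptionValue x (y + b) (SG G x y)
    take-back = subst (OptionValue x (y + b)) (cong (SG G x) y+b∸b≡y) (take (m≤n+m b y))

    transfer-shifts : ∀ {k} → 1 ≤ k → k ≤ x → ∀ c → SG G (x ∸ k) (y + b + c) ≡ flipLowBit (SG G (x ∸ k) (y + c))
    transfer-shifts k-pos k≤x c =
      trans (cong (SG G _) (xy∙z≈xz∙y y b c)) (shiftsBelow (∸-monoʳ-< k-pos k≤x) (y + c))

    transfer-unshifts : ∀ {k} → 1 ≤ k → k ≤ x → ∀ c → SG G (x ∸ k) (y + c) ≡ flipLowBit (SG G (x ∸ k) (y + b + c))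
    transfer-unshifts k-pos k≤x c = sym (trans (cong flipLowBit (transfer-shifts k-pos k≤x c)) (flipLowBit-involutive _))

    shift⁺ : ∀ {v} → OptionValue x y v → OptionValue x (y + b) (flipLowBit v)
    shift⁺ (take b≤y) = subst (OptionValue x (y + b)) take-shifts (take (m≤n+m b y))
      where
      open ≡-Reasoning
      take-shifts : SG G x (y + b ∸ b) ≡ flipLowBit (SG G x (y ∸ b))
      take-shifts = begin
        SG G x (y + b ∸ b)          ≡⟨ cong (SG G x) y+b∸b≡y ⟩
        SG G x y                    ≡⟨ cong (SG G x) (m∸n+n≡m b≤y) ⟨
        SG G x (y ∸ b + b)          ≡⟨ shiftsLeft (∸-monoʳ-< b-pos b≤y) ⟩
        flipLowBit (SG G x (y ∸ b)) ∎
    shift⁺ (transfer₁ p) = subst (OptionValue x (y + b)) (transfer-shifts x₁-pos p y₁) (transfer₁ p)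
    shift⁺ (transfer₂ p) = subst (OptionValue x (y + b)) (transfer-shifts x₂-pos p y₂) (transfer₂ p)

    shift⁻ : ∀ {v} → OptionValue x (y + b) v → v ≡ SG G x y ⊎ OptionValue x y (flipLowBit v)
    shift⁻ (take _)      = inj₁ (cong (SG G x) y+b∸b≡y)
    shift⁻ (transfer₁ p) = inj₂ (subst (OptionValue x y) (transfer-unshifts x₁-pos p y₁) (transfer₁ p))
    shift⁻ (transfer₂ p) = inj₂ (subst (OptionValue x y) (transfer-unshifts x₂-pos p y₂) (transfer₂ p))

  SG-shift : ∀ x y → Shifts x y
  SG-shift = <-rec _ λ x shiftsBelow → <-rec _ λ y shiftsLeft → SG-shift-step x y shiftsBelow shiftsLeft

mainTheorem5 : (G : LengyelGame) (x y : ℕ) →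
    SG G x (y + LengyelGame.b G) ≡ SG G x y ⊕ 1
mainTheorem5 G x y = trans (SG-shift G x y) (sym (⊕1≡flipLowBit (SG G x y)))
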